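{- Let $n\ge 2$. If a fractal $\mathsf{PHHF}(n-1;\kappa,(w_1,\dots,w_{n-1}),n-1)$ exists, then a $\mathsf{PHF}(n;n\kappa,\kappa+\sum_{i=1}^{n-1}w_i,n+1)$ exists.
   Context: An $\mathsf{HHF}(N;k,(w_1,\dots,w_N))$ is an $N\times k$ array in which row $i$ contains at most $w_i$ distinct symbols. Given a set $S$ of columns and a partition of $S$ into $p$ classes (some possibly empty), a row $r$ separates it if any two columns in distinct classes have distinct entries in row $r$. A $\mathsf{DHHF}(N;k,(w_1,\dots,w_N),t,p)$ is an $\mathsf{HHF}(N;k,(w_1,\dots,w_N))$ in which every partition of every $t$-set of columns into $p$ classes is separated by some row. A $\mathsf{PHHF}(N;k,(w_1,\dots,w_N),t)$ is a $\mathsf{DHHF}(N;k,(w_1,\dots,w_N),t,t)$; when all $w_i=w$ it is written $\mathsf{PHF}(N;k,w,t)$. A $\mathsf{DHHF}(t;k,(v_1,\dots,v_t),t,p)$ is fractal if $t\le 2$, or if for each row $j$, deleting row $j$ yields a fractal $\mathsf{DHHF}(t-1;k,(v_1,\dots,v_{j-1},v_{j+1},\dots,v_t),t-1,\min(p,t-1))$; a fractal $\mathsf{PHHF}$ is a fractal $\mathsf{DHHF}$ with $p=t$. -}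

module Defs where

open import Data.Nat using (ℕ; zero; suc; _+_; _⊔_; _⊓_)
open import Data.Fin using (Fin; zero; suc; punchIn)
open import Data.Product using (Σ; ∃; _×_; _,_)
open import Function.Definitions using (Injective)
open import Relation.Binary.PropositionalEquality using (_≡_)
open import Relation.Nullary using (¬_)

HHF : (N k : ℕ) → (w : Fin N → ℕ) → Set
HHF N k w = (i : Fin N) → Fin k → Fin (w i)

Separates : {N k t p : ℕ} {w : Fin N → ℕ} → HHF N k w →
            Fin N → (Fin t → Fin k) → (Fin t → Fin p) → Set
Separates A r c π = ∀ a b → ¬ (π a ≡ π b) → ¬ (A r (c a) ≡ A r (c b))

-- DHHF(N; k, w, t, p): every partition of every t-set of columns into p
-- classes (some possibly empty) is separated by some row.
IsDHHF : (N k : ℕ) (w : Fin N → ℕ) (t p : ℕ) → HHF N k w → Set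
IsDHHF N k w t p A =
  (c : Fin t → Fin k) → Injective _≡_ _≡_ c →
  (π : Fin t → Fin p) → ∃ λ r → Separates A r c π

IsPHHF : (N k : ℕ) (w : Fin N → ℕ) (t : ℕ) → HHF N k w → Set
IsPHHF N k w t = IsDHHF N k w t t

IsPHF : (N k w t : ℕ) → HHF N k (λ _ → w) → Set
IsPHF N k w t = IsPHHF N k (λ _ → w) t

IsFractalDHHF : (t k : ℕ) (v : Fin t → ℕ) (p : ℕ) → HHF t k v → Set
IsFractalDHHF zero k v p A = IsDHHF zero k v zero p A
IsFractalDHHF (suc zero) k v p A = IsDHHF 1 k v 1 p A
IsFractalDHHF (suc (suc zero)) k v p A = IsDHHF 2 k v 2 p A
IsFractalDHHF (suc (suc (suc t))) k v p A =
  IsDHHF (suc (suc (suc t))) k v (suc (suc (suc t))) p A ×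
  ((j : Fin (suc (suc (suc t)))) →
     IsFractalDHHF (suc (suc t)) k (λ i → v (punchIn j i))
                   (p ⊓ suc (suc t)) (λ i → A (punchIn j i)))

IsFractalPHHF : (t k : ℕ) (v : Fin t → ℕ) → HHF t k v → Set
IsFractalPHHF t k v = IsFractalDHHF t k v t

sumFin : (n : ℕ) → (Fin n → ℕ) → ℕ
sumFin zero w = 0
sumFin (suc n) w = w zero + sumFin n (λ i → w (suc i))

-- Group the n κ columns into n blocks of κ columns. Row r writes the position itself (κ
-- fresh symbols) on block r, and on every other block b row (r − b mod n) − 1 of the given
-- array A, tagged with that row so that different rows of A use disjoint symbols. Since
-- r − b is injective in r and in b, row r identifies two columns only if they lie in one
-- block b ≠ r and the corresponding row of A identifies their positions.
--
-- Suppose every row identifies two of n + 1 given columns, in a block β r ≠ r. There are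
-- n + 1 columns but only n rows, and β hits at least two blocks, so some block holds
-- 0 < g ≤ h columns while h rows r have β r = b. These rows copy distinct rows of A, and by
-- fractality (delete unused rows one at a time down to a full PHHF) among any g ≥ 1 rows
-- of A one is injective on any g columns: contradiction. So some row is injective on the
-- n + 1 columns, and such a row separates every partition of them.
module Submission where

open import Defs
open import Data.Empty using (⊥; ⊥-elim)
open import Data.Fin
  using (Fin; zero; suc; toℕ; fromℕ<; inject≤; punchIn; punchOut; _↑ˡ_; _↑ʳ_; splitAt;
         quotient; remainder; combine)
open import Data.Fin.Properties
  using (_≟_; any?; all?; toℕ<n; toℕ-fromℕ<; toℕ-injective; suc-injective; 0≢1+n; nonZeroIndex;
         injective⇒≤; punchOut-injective; punchIn-punchOut; ↑ˡ-injective; ↑ʳ-injective;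
         splitAt-↑ˡ; splitAt-↑ʳ; combine-remQuot; inject≤-injective)
open import Data.Nat using (ℕ; zero; suc; _+_; _*_; _∸_; _≤_; _<_; z≤n; s≤s; >-nonZero⁻¹)
import Data.Nat.Properties as ℕ
open import Data.Product using (Σ; ∃; ∃₂; _×_; _,_; proj₁; proj₂)
open import Data.Sum using (_⊎_; inj₁; inj₂)
open import Function using (_∘_; id)
open import Function.Definitions using (Injective)
open import Relation.Binary.PropositionalEquality
open import Relation.Nullary using (¬_; Dec; yes; no; ¬?; contradiction)
open import Relation.Nullary.Decidable using (_×-dec_; decidable-stable)

Wraps : ℕ → ℕ → ℕ → Set
Wraps n s x = s ≡ x ⊎ s ≡ x + n

<⇒≢+ : ∀ {n x} y → x < n → x ≢ y + n
<⇒≢+ {n} y x<n x≡y+n = ℕ.<⇒≱ x<n (subst (n ≤_) (sym x≡y+n) (ℕ.m≤n+m n y))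

Wraps-unique : ∀ {n s x x'} → x < n → x' < n → Wraps n s x → Wraps n s x' → x ≡ x'
Wraps-unique _ _ (inj₁ e) (inj₁ e') = trans (sym e) e'
Wraps-unique {n} _ _ (inj₂ e) (inj₂ e') = ℕ.+-cancelʳ-≡ n _ _ (trans (sym e) e')
Wraps-unique {x' = x'} x<n _ (inj₁ e) (inj₂ e') = ⊥-elim (<⇒≢+ x' x<n (trans (sym e) e'))
Wraps-unique x<n x'<n (inj₂ e) (inj₁ e') = sym (Wraps-unique x'<n x<n (inj₁ e') (inj₂ e))

Wraps-cancelˡ : ∀ {n d x y z} → y < n → z < n → Wraps n (d + y) x → Wraps n (d + z) x → y ≡ z
Wraps-cancelˡ {d = d} _ _ (inj₁ e) (inj₁ e') = ℕ.+-cancelˡ-≡ d _ _ (trans e (sym e'))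
Wraps-cancelˡ {d = d} _ _ (inj₂ e) (inj₂ e') = ℕ.+-cancelˡ-≡ d _ _ (trans e (sym e'))
Wraps-cancelˡ {n} {d} {y = y} _ z<n (inj₁ e) (inj₂ e') = ⊥-elim (<⇒≢+ y z<n z≡y+n)
  where
  z≡y+n = ℕ.+-cancelˡ-≡ d _ _ (trans e' (trans (cong (_+ n) (sym e)) (ℕ.+-assoc d y n)))
Wraps-cancelˡ y<n z<n (inj₂ e) (inj₁ e') = sym (Wraps-cancelˡ z<n y<n (inj₁ e') (inj₂ e))

_⊖_ : ∀ {n} → Fin n → Fin n → Fin n
_⊖_ {n} i j with toℕ j ℕ.≤? toℕ i
... | yes _ = fromℕ< (ℕ.≤-<-trans (ℕ.m∸n≤m (toℕ i) (toℕ j)) (toℕ<n i))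
... | no j≰i = fromℕ< {toℕ i + n ∸ toℕ j} (begin-strict
  toℕ i + n ∸ toℕ j     ≡⟨ ℕ.+-∸-assoc (toℕ i) (ℕ.<⇒≤ (toℕ<n j)) ⟩
  toℕ i + (n ∸ toℕ j)   <⟨ ℕ.+-monoˡ-< (n ∸ toℕ j) (ℕ.≰⇒> j≰i) ⟩
  toℕ j + (n ∸ toℕ j)   ≡⟨ ℕ.m+[n∸m]≡n (ℕ.<⇒≤ (toℕ<n j)) ⟩
  n                     ∎)
  where open ℕ.≤-Reasoning

toℕ-⊖ : ∀ {n} (i j : Fin n) → Wraps n (toℕ (i ⊖ j) + toℕ j) (toℕ i)
toℕ-⊖ {n} i j with toℕ j ℕ.≤? toℕ i
... | yes j≤i = inj₁ (trans (cong (_+ toℕ j) (toℕ-fromℕ< _)) (ℕ.m∸n+n≡m j≤i))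
... | no _ = inj₂ (trans (cong (_+ toℕ j) (toℕ-fromℕ< _))
                         (ℕ.m∸n+n≡m (ℕ.≤-trans (ℕ.<⇒≤ (toℕ<n j)) (ℕ.m≤n+m n (toℕ i)))))

⊖-injectiveˡ : ∀ {n} {i i' j : Fin n} → i ⊖ j ≡ i' ⊖ j → i ≡ i'
⊖-injectiveˡ {n} {i} {i'} {j} eq = toℕ-injective (Wraps-unique (toℕ<n i) (toℕ<n i')
  (toℕ-⊖ i j) (subst (λ d → Wraps n (toℕ d + toℕ j) (toℕ i')) (sym eq) (toℕ-⊖ i' j)))

⊖-injectiveʳ : ∀ {n} {i j j' : Fin n} → i ⊖ j ≡ i ⊖ j' → j ≡ j'
⊖-injectiveʳ {n} {i} {j} {j'} eq = toℕ-injective (Wraps-cancelˡ (toℕ<n j) (toℕ<n j')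
  (toℕ-⊖ i j) (subst (λ d → Wraps n (toℕ d + toℕ j') (toℕ i)) (sym eq) (toℕ-⊖ i j')))

⊖-self : ∀ {n} (i : Fin (suc n)) → i ⊖ i ≡ zero
⊖-self {n} i = toℕ-injective (Wraps-cancelˡ (toℕ<n (i ⊖ i)) (s≤s z≤n)
  (subst (λ s → Wraps (suc n) s (toℕ i)) (ℕ.+-comm (toℕ (i ⊖ i)) (toℕ i)) (toℕ-⊖ i i))
  (inj₁ (ℕ.+-comm (toℕ i) 0)))

sumFin-cong : ∀ n {f g : Fin n → ℕ} → (∀ i → f i ≡ g i) → sumFin n f ≡ sumFin n g
sumFin-cong zero _ = refl
sumFin-cong (suc n) f≗g = cong₂ _+_ (f≗g zero) (sumFin-cong n (f≗g ∘ suc))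

sumFin-mono-≤ : ∀ n {f g : Fin n → ℕ} → (∀ i → f i ≤ g i) → sumFin n f ≤ sumFin n g
sumFin-mono-≤ zero _ = z≤n
sumFin-mono-≤ (suc n) f≤g = ℕ.+-mono-≤ (f≤g zero) (sumFin-mono-≤ n (f≤g ∘ suc))

sumFin-mono-< : ∀ n {f g : Fin n → ℕ} → (∀ i → f i ≤ g i) → ∀ a → f a < g a →
                sumFin n f < sumFin n g
sumFin-mono-< (suc n) f≤g zero fa<ga = ℕ.+-mono-≤ fa<ga (sumFin-mono-≤ n (f≤g ∘ suc))
sumFin-mono-< (suc n) {f} f≤g (suc a) fa<ga =
  ℕ.≤-trans (ℕ.≤-reflexive (sym (ℕ.+-suc (f zero) _)))
          (ℕ.+-mono-≤ (f≤g zero) (sumFin-mono-< n (f≤g ∘ suc) a fa<ga))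

sumFin-mono-<₂ : ∀ n {f g : Fin n → ℕ} → (∀ i → f i ≤ g i) → ∀ {a a'} → a ≢ a' →
                 f a < g a → f a' < g a' → suc (sumFin n f) < sumFin n g
sumFin-mono-<₂ (suc n) f≤g {zero} {zero} a≢a' _ _ = contradiction refl a≢a'
sumFin-mono-<₂ (suc n) {f} f≤g {zero} {suc a'} _ fa<ga fa'<ga' =
  ℕ.≤-trans (ℕ.≤-reflexive (cong suc (sym (ℕ.+-suc (f zero) _))))
    (ℕ.+-mono-≤ fa<ga (sumFin-mono-< n (f≤g ∘ suc) a' fa'<ga'))
sumFin-mono-<₂ (suc n) {f} f≤g {suc a} {zero} _ fa<ga fa'<ga' =
  ℕ.≤-trans (ℕ.≤-reflexive (cong suc (sym (ℕ.+-suc (f zero) _))))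
    (ℕ.+-mono-≤ fa'<ga' (sumFin-mono-< n (f≤g ∘ suc) a fa<ga))
sumFin-mono-<₂ (suc n) {f} f≤g {suc a} {suc a'} a≢a' fa<ga fa'<ga' =
  ℕ.≤-trans (ℕ.≤-reflexive (cong suc (sym (ℕ.+-suc (f zero) _))))
    (ℕ.≤-trans (ℕ.≤-reflexive (sym (ℕ.+-suc (f zero) _)))
      (ℕ.+-mono-≤ (f≤g zero) (sumFin-mono-<₂ n (f≤g ∘ suc) (a≢a' ∘ cong suc) fa<ga fa'<ga')))

∃0<f≤g : ∀ n (f g : Fin n → ℕ) → (∀ i → 0 < g i → 0 < f i) →
         ∀ {a a'} → a ≢ a' → 0 < f a → 0 < f a' → sumFin n f ≤ suc (sumFin n g) →
         ∃ λ i → 0 < f i × f i ≤ g i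
∃0<f≤g n f g supp {a} {a'} a≢a' 0<fa 0<fa' Σf≤1+Σg
  with any? (λ i → (0 ℕ.<? f i) ×-dec (f i ℕ.≤? g i))
... | yes found = found
... | no none = contradiction Σf≤1+Σg
      (ℕ.<⇒≱ (sumFin-mono-<₂ n g≤f a≢a' (g<f a 0<fa) (g<f a' 0<fa')))
  where
  g<f : ∀ i → 0 < f i → g i < f i
  g<f i 0<fi = ℕ.≰⇒> (λ fi≤gi → none (i , 0<fi , fi≤gi))
  g≤f : ∀ i → g i ≤ f i
  g≤f i with g i ℕ.≤? f i
  ... | yes gi≤fi = gi≤fi
  ... | no gi≰fi = contradiction (g<f i (supp i (ℕ.≤-<-trans z≤n fi<gi))) (ℕ.<-asym fi<gi)
    where fi<gi = ℕ.≰⇒> gi≰fi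

sumFin-suc : ∀ n {f g : Fin n → ℕ} a → f a ≡ suc (g a) → (∀ i → i ≢ a → f i ≡ g i) →
             sumFin n f ≡ suc (sumFin n g)
sumFin-suc (suc n) zero fa≡1+ga f≗g =
  cong₂ _+_ fa≡1+ga (sumFin-cong n (λ i → f≗g (suc i) λ ()))
sumFin-suc (suc n) {f} {g} (suc a) fa≡1+ga f≗g = begin
  f zero + sumFin n (f ∘ suc)         ≡⟨ cong₂ _+_ (f≗g zero λ ()) tail ⟩
  g zero + suc (sumFin n (g ∘ suc))   ≡⟨ ℕ.+-suc (g zero) _ ⟩
  suc (sumFin (suc n) g)              ∎
  where
  open ≡-Reasoning
  tail = sumFin-suc n a fa≡1+ga (λ i i≢a → f≗g (suc i) (i≢a ∘ suc-injective))

fiberSize : ∀ {m n} → (Fin m → Fin n) → Fin n → ℕ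
fiberSize {zero} f b = 0
fiberSize {suc m} f b with f zero ≟ b
... | yes _ = suc (fiberSize (f ∘ suc) b)
... | no _ = fiberSize (f ∘ suc) b

fiber : ∀ {m n} (f : Fin m → Fin n) (b : Fin n) → Fin (fiberSize f b) → Fin m
fiber {suc m} f b i with f zero ≟ b
fiber {suc m} f b zero    | yes _ = zero
fiber {suc m} f b (suc i) | yes _ = suc (fiber (f ∘ suc) b i)
fiber {suc m} f b i       | no _ = suc (fiber (f ∘ suc) b i)

fiber-sound : ∀ {m n} (f : Fin m → Fin n) b i → f (fiber f b i) ≡ b
fiber-sound {suc m} f b i with f zero ≟ b
fiber-sound {suc m} f b zero    | yes f0≡b = f0≡b
fiber-sound {suc m} f b (suc i) | yes _ = fiber-sound (f ∘ suc) b i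
fiber-sound {suc m} f b i       | no _ = fiber-sound (f ∘ suc) b i

fiber-injective : ∀ {m n} (f : Fin m → Fin n) b → Injective _≡_ _≡_ (fiber f b)
fiber-injective {suc m} f b {i} {j} eq with f zero ≟ b
fiber-injective {suc m} f b {zero}  {zero}  eq | yes _ = refl
fiber-injective {suc m} f b {suc i} {suc j} eq | yes _ =
  cong suc (fiber-injective (f ∘ suc) b (suc-injective eq))
fiber-injective {suc m} f b {i}     {j}     eq | no _ =
  fiber-injective (f ∘ suc) b (suc-injective eq)

fiber-complete : ∀ {m n} (f : Fin m → Fin n) {b} a → f a ≡ b → ∃ λ i → fiber f b i ≡ a
fiber-complete {suc m} f {b} a fa≡b with f zero ≟ b
fiber-complete {suc m} f {b} zero    fa≡b | yes _ = zero , refl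
fiber-complete {suc m} f {b} (suc a) fa≡b | yes _ with i , eq ← fiber-complete (f ∘ suc) a fa≡b =
  suc i , cong suc eq
fiber-complete {suc m} f {b} zero    fa≡b | no f0≢b = contradiction fa≡b f0≢b
fiber-complete {suc m} f {b} (suc a) fa≡b | no _ with i , eq ← fiber-complete (f ∘ suc) a fa≡b =
  i , cong suc eq

fiber-nonempty : ∀ {m n} (f : Fin m → Fin n) {b} a → f a ≡ b → 0 < fiberSize f b
fiber-nonempty f a fa≡b = >-nonZero⁻¹ _ {{nonZeroIndex (proj₁ (fiber-complete f a fa≡b))}}

0<fiberSize⇒∃ : ∀ {m n} (f : Fin m → Fin n) {b} → 0 < fiberSize f b → ∃ λ a → f a ≡ b
0<fiberSize⇒∃ f {b} 0<size = fiber f b (fromℕ< 0<size) , fiber-sound f b _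

sumFin-fiberSize : ∀ {m} n (f : Fin m → Fin n) → sumFin n (fiberSize f) ≡ m
sumFin-fiberSize {zero} n f = sumFin-zero n
  where
  sumFin-zero : ∀ n → sumFin n (λ _ → 0) ≡ 0
  sumFin-zero zero = refl
  sumFin-zero (suc n) = sumFin-zero n
sumFin-fiberSize {suc m} n f =
  trans (sumFin-suc n (f zero) head tail) (cong suc (sumFin-fiberSize n (f ∘ suc)))
  where
  head : fiberSize f (f zero) ≡ suc (fiberSize (f ∘ suc) (f zero))
  head with f zero ≟ f zero
  ... | yes _ = refl
  ... | no f0≢f0 = contradiction refl f0≢f0
  tail : ∀ b → b ≢ f zero → fiberSize f b ≡ fiberSize (f ∘ suc) b
  tail b b≢f0 with f zero ≟ b
  ... | yes f0≡b = contradiction (sym f0≡b) b≢f0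
  ... | no _ = refl

injective⇒surjective : ∀ {m} {f : Fin m → Fin m} → Injective _≡_ _≡_ f →
                       ∀ j → ∃ λ i → f i ≡ j
injective⇒surjective {suc m} {f} f-inj j with any? (λ i → f i ≟ j)
... | yes hit = hit
... | no unhit = contradiction (injective⇒≤ punchOut∘f-inj) ℕ.1+n≰n
  where
  f≢j : ∀ i → j ≢ f i
  f≢j i j≡fi = unhit (i , sym j≡fi)
  punchOut∘f-inj : Injective _≡_ _≡_ (λ i → punchOut (f≢j i))
  punchOut∘f-inj eq = f-inj (punchOut-injective (f≢j _) (f≢j _) eq)

<⇒∃-notInImage : ∀ {c m} → c < m → (f : Fin c → Fin m) → ∃ λ j → ∀ i → f i ≢ j
<⇒∃-notInImage {c} {m} c<m f with any? (λ j → all? (λ i → ¬? (f i ≟ j)))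
... | yes unhit = unhit
... | no none = contradiction (injective⇒≤ section-inj) (ℕ.<⇒≱ c<m)
  where
  hit : ∀ j → ∃ λ i → f i ≡ j
  hit j with any? (λ i → f i ≟ j)
  ... | yes found = found
  ... | no unhit = contradiction (j , λ i fi≡j → unhit (i , fi≡j)) none
  section-inj : Injective _≡_ _≡_ (proj₁ ∘ hit)
  section-inj {j} {j'} eq = trans (sym (proj₂ (hit j))) (trans (cong f eq) (proj₂ (hit j')))

Collision : ∀ {t} {B : Set} → (Fin t → B) → Set
Collision f = ∃₂ λ a a' → a ≢ a' × f a ≡ f a'

collision? : ∀ {t s} (f : Fin t → Fin s) → Dec (Collision f)
collision? f = any? λ a → any? λ a' → ¬? (a ≟ a') ×-dec (f a ≟ f a')

¬collision⇒injective : ∀ {t} {B : Set} {f : Fin t → B} → ¬ Collision f → Injective _≡_ _≡_ f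
¬collision⇒injective noCollision {a} {a'} eq with a ≟ a'
... | yes a≡a' = a≡a'
... | no a≢a' = contradiction (a , a' , a≢a' , eq) noCollision

module _ {N k t} {w : Fin N → ℕ} (A : HHF N k w) (r : Fin N) (c : Fin t → Fin k) where

  injective⇒separates : Injective _≡_ _≡_ (A r ∘ c) →
                        ∀ {p} (π : Fin t → Fin p) → Separates A r c π
  injective⇒separates inj π a b πa≢πb eq = πa≢πb (cong π (inj eq))

  separates⇒injective : Separates A r c id → Injective _≡_ _≡_ (A r ∘ c)
  separates⇒injective sep {a} {b} eq with a ≟ b
  ... | yes a≡b = a≡b
  ... | no a≢b = contradiction eq (sep a b a≢b)

InjectiveRows : ∀ {m k w} → HHF m k w → Set
InjectiveRows {m} {k} A = ∀ {c} → 0 < c →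
  (ρ : Fin c → Fin m) → Injective _≡_ _≡_ ρ →
  (col : Fin c → Fin k) → Injective _≡_ _≡_ col →
  ∃ λ i → Injective _≡_ _≡_ (A (ρ i) ∘ col)

InjectiveRows-≤1 : ∀ {m k w} (A : HHF m k w) → m ≤ 1 → InjectiveRows A
InjectiveRows-≤1 A m≤1 {suc zero} _ ρ _ col _ = zero , λ { {zero} {zero} _ → refl }
InjectiveRows-≤1 A m≤1 {suc (suc c)} _ ρ ρ-inj =
  contradiction (ℕ.≤-trans (injective⇒≤ ρ-inj) m≤1) λ { (s≤s ()) }

IsPHHF-deleteRows⇒InjectiveRows : ∀ {m k w} (A : HHF (suc m) k w) → IsPHHF (suc m) k w (suc m) A →
                                  (∀ j → InjectiveRows (A ∘ punchIn j)) → InjectiveRows A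
IsPHHF-deleteRows⇒InjectiveRows {m} A phhf deleted {c} 0<c ρ ρ-inj col col-inj
  with c ℕ.≟ suc m
... | yes refl with r , sep ← phhf col col-inj id
                with i , refl ← injective⇒surjective ρ-inj r = i , separates⇒injective A r col sep
... | no c≢m with j , unhit ← <⇒∃-notInImage (ℕ.≤∧≢⇒< (injective⇒≤ ρ-inj) c≢m) ρ =
  proj₁ inDeleted , subst (λ r → Injective _≡_ _≡_ (A r ∘ col))
                          (punchIn-punchOut (j≢ρ (proj₁ inDeleted))) (proj₂ inDeleted)
  where
  j≢ρ : ∀ i → j ≢ ρ i
  j≢ρ i j≡ρi = unhit i (sym j≡ρi)
  ρ' : Fin c → Fin m
  ρ' i = punchOut (j≢ρ i)
  ρ'-inj : Injective _≡_ _≡_ ρ'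
  ρ'-inj eq = ρ-inj (punchOut-injective (j≢ρ _) (j≢ρ _) eq)
  inDeleted = deleted j 0<c ρ' ρ'-inj col col-inj

IsFractalPHHF-deleteRow : ∀ m {k w} (A : HHF (suc (suc (suc m))) k w) →
                          IsFractalPHHF (suc (suc (suc m))) k w A → ∀ j →
                          IsFractalPHHF (suc (suc m)) k (w ∘ punchIn j) (A ∘ punchIn j)
IsFractalPHHF-deleteRow m {k} {w} A F j =
  subst (λ p → IsFractalDHHF (suc (suc m)) k (w ∘ punchIn j) p (A ∘ punchIn j))
        (ℕ.m≥n⇒m⊓n≡n (ℕ.n≤1+n (suc (suc m)))) (proj₂ F j)

IsFractalPHHF⇒InjectiveRows : ∀ m {k w} (A : HHF m k w) → IsFractalPHHF m k w A → InjectiveRows A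
IsFractalPHHF⇒InjectiveRows zero A _ = InjectiveRows-≤1 A z≤n
IsFractalPHHF⇒InjectiveRows (suc zero) A _ = InjectiveRows-≤1 A ℕ.≤-refl
IsFractalPHHF⇒InjectiveRows (suc (suc zero)) A F =
  IsPHHF-deleteRows⇒InjectiveRows A F (λ j → InjectiveRows-≤1 (A ∘ punchIn j) ℕ.≤-refl)
IsFractalPHHF⇒InjectiveRows (suc (suc (suc m))) A F =
  IsPHHF-deleteRows⇒InjectiveRows A (proj₁ F) (λ j →
    IsFractalPHHF⇒InjectiveRows (suc (suc m)) (A ∘ punchIn j) (IsFractalPHHF-deleteRow m A F j))

↑ˡ≢↑ʳ : ∀ {a b} (x : Fin a) (y : Fin b) → x ↑ˡ b ≢ a ↑ʳ y
↑ˡ≢↑ʳ {a} {b} x y eq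
  with trans (sym (splitAt-↑ˡ a x b)) (trans (cong (splitAt a) eq) (splitAt-↑ʳ a b y))
... | ()

tag : ∀ {m} (w : Fin m → ℕ) (j : Fin m) → Fin (w j) → Fin (sumFin m w)
tag w zero x = x ↑ˡ _
tag w (suc j) x = w zero ↑ʳ tag (w ∘ suc) j x

tag-injectiveˡ : ∀ {m} (w : Fin m → ℕ) {j j' x x'} → tag w j x ≡ tag w j' x' → j ≡ j'
tag-injectiveˡ w {zero} {zero} _ = refl
tag-injectiveˡ w {zero} {suc j'} eq = contradiction eq (↑ˡ≢↑ʳ _ _)
tag-injectiveˡ w {suc j} {zero} eq = contradiction (sym eq) (↑ˡ≢↑ʳ _ _)
tag-injectiveˡ w {suc j} {suc j'} eq =
  cong suc (tag-injectiveˡ (w ∘ suc) (↑ʳ-injective (w zero) _ _ eq))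

tag-injectiveʳ : ∀ {m} (w : Fin m → ℕ) {j x x'} → tag w j x ≡ tag w j x' → x ≡ x'
tag-injectiveʳ w {zero} eq = ↑ˡ-injective _ _ _ eq
tag-injectiveʳ w {suc j} eq = tag-injectiveʳ (w ∘ suc) (↑ʳ-injective (w zero) _ _ eq)

module Extension {m κ : ℕ} {w : Fin m → ℕ} (A : HHF m κ w) where

  block : Fin (suc m * κ) → Fin (suc m)
  block = quotient κ

  position : Fin (suc m * κ) → Fin κ
  position = remainder {suc m} κ

  block-position-injective : ∀ {x y} → block x ≡ block y → position x ≡ position y → x ≡ y
  block-position-injective {x} {y} eq eq' =
    trans (sym (combine-remQuot {suc m} κ x)) (trans (cong₂ combine eq eq') (combine-remQuot κ y))

  symbol : Fin (suc m) → Fin κ → Fin (κ + sumFin m w)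
  symbol zero x = x ↑ˡ sumFin m w
  symbol (suc s) x = κ ↑ʳ tag w s (A s x)

  symbol-injectiveˡ : ∀ {d d' x x'} → symbol d x ≡ symbol d' x' → d ≡ d'
  symbol-injectiveˡ {zero} {zero} _ = refl
  symbol-injectiveˡ {zero} {suc _} eq = contradiction eq (↑ˡ≢↑ʳ _ _)
  symbol-injectiveˡ {suc _} {zero} eq = contradiction (sym eq) (↑ˡ≢↑ʳ _ _)
  symbol-injectiveˡ {suc s} {suc s'} eq = cong suc (tag-injectiveˡ w (↑ʳ-injective κ _ _ eq))

  extend : HHF (suc m) (suc m * κ) (λ _ → κ + sumFin m w)
  extend r x = symbol (r ⊖ block x) (position x)

  symbol-collision : ∀ d {x x'} → symbol d x ≡ symbol d x' →
                     x ≡ x' ⊎ ∃ λ s → d ≡ suc s × A s x ≡ A s x'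
  symbol-collision zero eq = inj₁ (↑ˡ-injective _ _ _ eq)
  symbol-collision (suc s) eq = inj₂ (s , refl , tag-injectiveʳ w (↑ʳ-injective κ _ _ eq))

  record Clash {t} (c : Fin t → Fin (suc m * κ)) (r : Fin (suc m)) : Set where
    field
      a a'           : Fin t
      a≢a'           : a ≢ a'
      sameBlock      : block (c a') ≡ block (c a)
      row            : Fin m
      r⊖block≡1+row  : r ⊖ block (c a) ≡ suc row
      rowCollision   : A row (position (c a)) ≡ A row (position (c a'))

  extend-sameBlock : ∀ {r x y} → extend r x ≡ extend r y → block y ≡ block x
  extend-sameBlock eq = sym (⊖-injectiveʳ (symbol-injectiveˡ eq))

  collision⇒Clash : ∀ {t} {c : Fin t → Fin (suc m * κ)} → Injective _≡_ _≡_ c →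
                    ∀ {r} → Collision (extend r ∘ c) → Clash c r
  collision⇒Clash {c = c} c-inj {r} (a , a' , a≢a' , eq)
    with symbol-collision (r ⊖ block (c a))
           (subst (λ b → extend r (c a) ≡ symbol (r ⊖ b) _) (extend-sameBlock eq) eq)
  ... | inj₁ samePosition =
    contradiction (c-inj (block-position-injective (sym (extend-sameBlock eq)) samePosition)) a≢a'
  ... | inj₂ (s , r⊖b≡1+s , rowCollision) = record
    { a = a ; a' = a' ; a≢a' = a≢a' ; sameBlock = extend-sameBlock eq ; row = s
    ; r⊖block≡1+row = r⊖b≡1+s ; rowCollision = rowCollision }

  module _ {t} {c : Fin t → Fin (suc m * κ)} (c-inj : Injective _≡_ _≡_ c)
           (clash : ∀ r → Clash c r) where
    open Clash

    clashBlock : Fin (suc m) → Fin (suc m)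
    clashBlock r = block (c (a (clash r)))

    columnsIn rowsIn : Fin (suc m) → ℕ
    columnsIn = fiberSize (block ∘ c)
    rowsIn = fiberSize clashBlock

    clashBlock≢ : ∀ r → clashBlock r ≢ r
    clashBlock≢ r eq = 0≢1+n (begin
      zero                 ≡⟨ sym (⊖-self r) ⟩
      r ⊖ r                ≡⟨ cong (r ⊖_) (sym eq) ⟩
      r ⊖ clashBlock r     ≡⟨ r⊖block≡1+row (clash r) ⟩
      suc (row (clash r))  ∎)
      where open ≡-Reasoning

    0<columnsIn-clashBlock : ∀ r → 0 < columnsIn (clashBlock r)
    0<columnsIn-clashBlock r = fiber-nonempty (block ∘ c) (a (clash r)) refl

    0<rowsIn⇒0<columnsIn : ∀ b → 0 < rowsIn b → 0 < columnsIn b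
    0<rowsIn⇒0<columnsIn b 0<rows with r , refl ← 0<fiberSize⇒∃ clashBlock 0<rows =
      0<columnsIn-clashBlock r

    module _ (b : Fin (suc m)) (columns≤rows : columnsIn b ≤ rowsIn b) where

      clashRow : Fin (columnsIn b) → Fin (suc m)
      clashRow i = fiber clashBlock b (inject≤ i columns≤rows)

      copiedRow : Fin (columnsIn b) → Fin m
      copiedRow i = row (clash (clashRow i))

      clashRow⊖b : ∀ i → clashRow i ⊖ b ≡ suc (copiedRow i)
      clashRow⊖b i = subst (λ b' → clashRow i ⊖ b' ≡ suc (copiedRow i))
                           (fiber-sound clashBlock b _) (r⊖block≡1+row (clash (clashRow i)))

      copiedRow-injective : Injective _≡_ _≡_ copiedRow
      copiedRow-injective eq = inject≤-injective _ _ _ _ (fiber-injective clashBlock b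
        (⊖-injectiveˡ {j = b} (trans (clashRow⊖b _) (trans (cong suc eq) (sym (clashRow⊖b _))))))

      blockColumn : Fin (columnsIn b) → Fin t
      blockColumn = fiber (block ∘ c) b

      positions : Fin (columnsIn b) → Fin κ
      positions = position ∘ c ∘ blockColumn

      positions-injective : Injective _≡_ _≡_ positions
      positions-injective eq = fiber-injective (block ∘ c) b (c-inj (block-position-injective
        (trans (fiber-sound (block ∘ c) b _) (sym (fiber-sound (block ∘ c) b _))) eq))

      copiedRow-notInjective : ∀ i → ¬ Injective _≡_ _≡_ (A (copiedRow i) ∘ positions)
      copiedRow-notInjective i inj = a≢a' cl (begin
        a cl                          ≡⟨ sym (proj₂ a-index) ⟩
        blockColumn (proj₁ a-index)   ≡⟨ cong blockColumn (inj collision) ⟩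
        blockColumn (proj₁ a'-index)  ≡⟨ proj₂ a'-index ⟩
        a' cl                         ∎)
        where
        open ≡-Reasoning
        cl = clash (clashRow i)
        a∈b : block (c (a cl)) ≡ b
        a∈b = fiber-sound clashBlock b _
        a-index = fiber-complete (block ∘ c) (a cl) a∈b
        a'-index = fiber-complete (block ∘ c) (a' cl) (trans (sameBlock cl) a∈b)
        collision = subst₂ (λ x y → A (copiedRow i) (position (c x)) ≡
                                    A (copiedRow i) (position (c y)))
                           (sym (proj₂ a-index)) (sym (proj₂ a'-index)) (rowCollision cl)

    allRowsClash⇒⊥ : InjectiveRows A → t ≤ suc (suc m) → ⊥
    allRowsClash⇒⊥ injRows t≤2+m =
      let b , 0<columns , columns≤rows = ∃0<f≤g (suc m) columnsIn rowsIn 0<rowsIn⇒0<columnsIn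
                                           (clashBlock≢ b₁ ∘ sym) (0<columnsIn-clashBlock zero)
                                           (0<columnsIn-clashBlock b₁) Σcolumns≤1+Σrows
          i , inj = injRows 0<columns (copiedRow b columns≤rows) (copiedRow-injective b columns≤rows)
                             (positions b columns≤rows) (positions-injective b columns≤rows)
      in copiedRow-notInjective b columns≤rows i inj
      where
      b₁ = clashBlock zero
      Σcolumns≤1+Σrows : sumFin (suc m) columnsIn ≤ suc (sumFin (suc m) rowsIn)
      Σcolumns≤1+Σrows = begin
        sumFin (suc m) columnsIn        ≡⟨ sumFin-fiberSize (suc m) (block ∘ c) ⟩
        t                               ≤⟨ t≤2+m ⟩
        suc (suc m)                     ≡⟨ cong suc (sym (sumFin-fiberSize (suc m) clashBlock)) ⟩
        suc (sumFin (suc m) rowsIn)     ∎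
        where open ℕ.≤-Reasoning

  extend-injectiveRow : InjectiveRows A → ∀ {t} → t ≤ suc (suc m) →
                        (c : Fin t → Fin (suc m * κ)) → Injective _≡_ _≡_ c →
                        ∃ λ r → Injective _≡_ _≡_ (extend r ∘ c)
  extend-injectiveRow injRows t≤2+m c c-inj with any? (λ r → ¬? (collision? (extend r ∘ c)))
  ... | yes (r , noCollision) = r , ¬collision⇒injective noCollision
  ... | no none = ⊥-elim (allRowsClash⇒⊥ c-inj clash injRows t≤2+m)
    where
    clash : ∀ r → Clash c r
    clash r = collision⇒Clash c-inj
      (decidable-stable (collision? (extend r ∘ c)) (λ noCollision → none (r , noCollision)))

  extend-isPHF : IsFractalPHHF m κ w A → IsPHF (suc m) (suc m * κ) (κ + sumFin m w) (suc m + 1) extend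
  extend-isPHF F c c-inj π =
    let r , inj = extend-injectiveRow (IsFractalPHHF⇒InjectiveRows m A F)
                                      (ℕ.≤-reflexive (ℕ.+-comm (suc m) 1)) c c-inj
    in r , injective⇒separates extend r c inj π

open Extension using (extend; extend-isPHF)

lemma18 : (n : ℕ) → 2 ≤ n → (κ : ℕ) → (w : Fin (n ∸ 1) → ℕ) →
          Σ (HHF (n ∸ 1) κ w) (IsFractalPHHF (n ∸ 1) κ w) →
          Σ (HHF n (n * κ) (λ _ → κ + sumFin (n ∸ 1) w))
            (IsPHF n (n * κ) (κ + sumFin (n ∸ 1) w) (n + 1))
-- The construction works for every n ≥ 1; the hypothesis 2 ≤ n only excludes n = 0.
lemma18 zero ()
lemma18 (suc m) _ κ w (A , F) = extend A , extend-isPHF A F
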